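{- The identity morphisms of $\mathrm{Int}(\mathbf{Rel})$ are positive maps, and the $\mathrm{Int}(\mathbf{Rel})$-composite of two positive maps is a positive map; hence $\mathbf{Pos}$, with the identities and composition of $\mathrm{Int}(\mathbf{Rel})$, forms a category.
   Context: $\mathbf{Rel}$ is the category of sets and binary relations; relational composition is written right to left by juxtaposition, $R^*=\bigcup_{n\ge0}R^n$ (with $R^0$ the identity), and for $R\subseteq A\times B$, $X\subseteq A$, $Y\subseteq B$: $R[X]=\{y\mid\exists a\in X,(a,y)\in R\}$, $[Y]R=\{x\mid\exists b\in Y,(x,b)\in R\}$. $\mathrm{Int}(\mathbf{Rel})$ (with tensor = disjoint union $+$): objects are pairs of sets $(A^+,A^-)$; a morphism $R:(A^+,A^-)\to(B^+,B^-)$ is a relation $A^++B^-\to B^++A^-$, equivalently four relations $R_{12}:A^+\to B^+$, $R_{11}:A^+\to A^-$, $R_{21}:B^-\to A^-$, $R_{22}:B^-\to B^+$. The identity on $(A^+,A^-)$ has $R_{12}=\mathrm{Id}_{A^+}$, $R_{21}=\mathrm{Id}_{A^- }$, $R_{11}=R_{22}=\emptyset$. For $S:(B^+,B^-)\to(C^+,C^-)$ the composite $SR:(A^+,A^-)\to(C^+,C^-)$ has $(SR)_{12}=S_{12}(R_{22}S_{11})^*R_{12}$, $(SR)_{22}=S_{22}\cup S_{12}R_{22}(S_{11}R_{22})^*S_{21}$, $(SR)_{11}=R_{11}\cup R_{21}S_{11}(R_{22}S_{11})^*R_{12}$, $(SR)_{21}=R_{21}(S_{11}R_{22})^*S_{21}$.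 $\mathbf{Pos}$: objects are $(A^+_{\mathrm{mp}(A^+)},A^-_{\mathrm{mp}(A^-)})$ where $(A^+,A^-)$ is an object of $\mathrm{Int}(\mathbf{Rel})$ and $\mathrm{mp}(A^+)\subseteq A^+$, $\mathrm{mp}(A^-)\subseteq A^-$ are chosen subsets (multipoints). A positive map $(A^+_{\mathrm{mp}(A^+)},A^-_{\mathrm{mp}(A^-)})\to(B^+_{\mathrm{mp}(B^+)},B^-_{\mathrm{mp}(B^-)})$ is a morphism $R:(A^+,A^-)\to(B^+,B^-)$ of $\mathrm{Int}(\mathbf{Rel})$ such that (1) $[\mathrm{mp}(B^+)]R_{12}=\mathrm{mp}(A^+)$, (2) $R_{21}[\mathrm{mp}(B^-)]=\mathrm{mp}(A^-)$, (3) $[\mathrm{mp}(B^+)]R_{22}=\emptyset=R_{22}[\mathrm{mp}(B^-)]$. -}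

module Defs where

open import Level using (0ℓ)
open import Data.Empty using (⊥)
open import Data.Product using (Σ; ∃; _×_; _,_)
open import Relation.Binary.Core using (REL)
open import Relation.Binary.PropositionalEquality using (_≡_)
open import Relation.Binary.Construct.Closure.ReflexiveTransitive using (Star)
open import Relation.Unary using (Pred; _≐_; ∅; _∪_)

Relation : Set → Set → Set₁
Relation A B = REL A B 0ℓ

-- Relational composition written right-to-left:  (S ⊙ R) means "first R, then S".
_⊙_ : {A B C : Set} → Relation B C → Relation A B → Relation A C
(S ⊙ R) a c = ∃ λ b → R a b × S b c

infixr 9 _⊙_

_∪ᵣ_ : {A B : Set} → Relation A B → Relation A B → Relation A B
(R ∪ᵣ S) a b = R a b ⊎' S a b
  where
  open import Data.Sum using () renaming (_⊎_ to _⊎'_)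

_* : {A : Set} → Relation A A → Relation A A
R * = Star R

IdR : {A : Set} → Relation A A
IdR = _≡_

EmptyR : {A B : Set} → Relation A B
EmptyR _ _ = ⊥

image : {A B : Set} → Relation A B → Pred A 0ℓ → Pred B 0ℓ
image R X y = ∃ λ a → X a × R a y

preimage : {A B : Set} → Pred B 0ℓ → Relation A B → Pred A 0ℓ
preimage Y R x = ∃ λ b → Y b × R x b

record IntObj : Set₁ where
  constructor _,,_
  field
    pos : Set
    neg : Set
open IntObj public

-- Morphisms of Int(Rel), as the four component relations
record IntMor (A B : IntObj) : Set₁ where
  field
    r12 : Relation (pos A) (pos B)
    r11 : Relation (pos A) (neg A)
    r21 : Relation (neg B) (neg A)
    r22 : Relation (neg B) (pos B)
open IntMor public

idInt : (A : IntObj) → IntMor A A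
r12 (idInt A) = IdR
r11 (idInt A) = EmptyR
r21 (idInt A) = IdR
r22 (idInt A) = EmptyR

compInt : {A B C : IntObj} → IntMor B C → IntMor A B → IntMor A C
r12 (compInt S R) = r12 S ⊙ ((r22 R ⊙ r11 S) *) ⊙ r12 R
r22 (compInt S R) = r22 S ∪ᵣ (r12 S ⊙ r22 R ⊙ ((r11 S ⊙ r22 R) *) ⊙ r21 S)
r11 (compInt S R) = r11 R ∪ᵣ (r21 R ⊙ r11 S ⊙ ((r22 R ⊙ r11 S) *) ⊙ r12 R)
r21 (compInt S R) = r21 R ⊙ ((r11 S ⊙ r22 R) *) ⊙ r21 S

record PosObj : Set₁ where
  field
    obj : IntObj
    mpPos : Pred (pos obj) 0ℓ
    mpNeg : Pred (neg obj) 0ℓ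
open PosObj public

record IsPositive (A B : PosObj) (R : IntMor (obj A) (obj B)) : Set₁ where
  field
    cond1  : preimage (mpPos B) (r12 R) ≐ mpPos A
    cond2  : image (r21 R) (mpNeg B) ≐ mpNeg A
    cond3a : preimage (mpPos B) (r22 R) ≐ ∅
    cond3b : image (r22 R) (mpNeg B) ≐ ∅

-- Condition (3) says the feedback component r22 of a positive map neither enters mp(B⁺)
-- nor leaves mp(B⁻). Hence in a composite S R the feedback loops (r22 R ⊙ r11 S)* and
-- (r11 S ⊙ r22 R)* fix the multipoints of B, and each positivity condition of S R reduces,
-- by a calculation with images and preimages, to the corresponding conditions of S and R.
module Submission where

open import Defs
open import Level using (0ℓ; suc)
open import Data.Empty using (⊥-elim)
open import Data.Product using (_×_; _,_)
open import Data.Sum using (inj₁; inj₂; [_,_])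
open import Relation.Binary.Bundles using (Setoid)
open import Relation.Binary.PropositionalEquality using (refl)
open import Relation.Binary.Construct.Closure.ReflexiveTransitive using (ε; _◅_)
open import Relation.Unary using (Pred; _≐_; ∅; _∪_)
open import Relation.Unary.Properties using (≐-refl; ≐-sym; ≐-trans)
import Relation.Binary.Reasoning.Setoid as SetoidReasoning

≐-setoid : Set → Setoid (suc 0ℓ) 0ℓ
≐-setoid X = record
  { Carrier       = Pred X 0ℓ
  ; _≈_           = _≐_
  ; isEquivalence = record { refl = ≐-refl ; sym = ≐-sym ; trans = ≐-trans }
  }

module ≐-Reasoning {X : Set} = SetoidReasoning (≐-setoid X)
open ≐-Reasoning

∪-≐∅ : {X : Set} {P Q : Pred X 0ℓ} → P ≐ ∅ → Q ≐ ∅ → P ∪ Q ≐ ∅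
∪-≐∅ (P⊆∅ , _) (Q⊆∅ , _) = [ P⊆∅ , Q⊆∅ ] , λ ()

module _ {A B : Set} where

  preimage-cong : {Y Y′ : Pred B 0ℓ} {R : Relation A B} → Y ≐ Y′ → preimage Y R ≐ preimage Y′ R
  preimage-cong (Y⊆Y′ , Y′⊆Y) = (λ (b , y , r) → b , Y⊆Y′ y , r) , (λ (b , y , r) → b , Y′⊆Y y , r)

  image-cong : {X X′ : Pred A 0ℓ} {R : Relation A B} → X ≐ X′ → image R X ≐ image R X′
  image-cong (X⊆X′ , X′⊆X) = (λ (a , x , r) → a , X⊆X′ x , r) , (λ (a , x , r) → a , X′⊆X x , r)

  preimage-∪ᵣ : {Y : Pred B 0ℓ} {R S : Relation A B}
    → preimage Y (R ∪ᵣ S) ≐ preimage Y R ∪ preimage Y S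
  preimage-∪ᵣ = (λ { (b , y , inj₁ r) → inj₁ (b , y , r) ; (b , y , inj₂ s) → inj₂ (b , y , s) })
              , (λ { (inj₁ (b , y , r)) → b , y , inj₁ r ; (inj₂ (b , y , s)) → b , y , inj₂ s })

  image-∪ᵣ : {X : Pred A 0ℓ} {R S : Relation A B} → image (R ∪ᵣ S) X ≐ image R X ∪ image S X
  image-∪ᵣ = (λ { (a , x , inj₁ r) → inj₁ (a , x , r) ; (a , x , inj₂ s) → inj₂ (a , x , s) })
           , (λ { (inj₁ (a , x , r)) → a , x , inj₁ r ; (inj₂ (a , x , s)) → a , x , inj₂ s })

module _ {A : Set} where

  preimage-IdR : {Y : Pred A 0ℓ} → preimage Y IdR ≐ Y
  preimage-IdR = (λ { (_ , y , refl) → y }) , λ y → _ , y , refl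

  image-IdR : {X : Pred A 0ℓ} → image IdR X ≐ X
  image-IdR = (λ { (_ , x , refl) → x }) , λ x → _ , x , refl

  preimage-EmptyR : {B : Set} {Y : Pred B 0ℓ} → preimage Y (EmptyR {A}) ≐ ∅
  preimage-EmptyR = (λ ()) , λ ()

  image-EmptyR : {B : Set} {X : Pred B 0ℓ} → image EmptyR X ≐ ∅ {A = A}
  image-EmptyR = (λ ()) , λ ()

module _ {A B C : Set} {R : Relation A B} {S : Relation B C} where

  preimage-⊙ : {Y : Pred C 0ℓ} → preimage Y (S ⊙ R) ≐ preimage (preimage Y S) R
  preimage-⊙ = (λ (c , y , b , r , s) → b , (c , y , s) , r)
             , (λ (b , (c , y , s) , r) → c , y , b , r , s)

  image-⊙ : {X : Pred A 0ℓ} → image (S ⊙ R) X ≐ image S (image R X)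
  image-⊙ = (λ (a , x , b , r , s) → b , (a , x , r) , s)
          , (λ (b , (a , x , r) , s) → a , x , b , r , s)

  preimage-⊙-≐∅ : {Y : Pred C 0ℓ} → preimage Y S ≐ ∅ → preimage Y (S ⊙ R) ≐ ∅
  preimage-⊙-≐∅ {Y} Y∘S≐∅ = begin
    preimage Y (S ⊙ R)           ≈⟨ preimage-⊙ ⟩
    preimage (preimage Y S) R    ≈⟨ preimage-cong Y∘S≐∅ ⟩
    preimage ∅ R                 ≈⟨ (λ ()) , (λ ()) ⟩
    ∅                            ∎

  image-⊙-≐∅ : {X : Pred A 0ℓ} → image R X ≐ ∅ → image (S ⊙ R) X ≐ ∅
  image-⊙-≐∅ {X} R∘X≐∅ = begin
    image (S ⊙ R) X        ≈⟨ image-⊙ ⟩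
    image S (image R X)    ≈⟨ image-cong R∘X≐∅ ⟩
    image S ∅              ≈⟨ (λ ()) , (λ ()) ⟩
    ∅                      ∎

module _ {X : Set} {T : Relation X X} {P : Pred X 0ℓ} where

  -- Only the last step of a path can enter P, so a path ending in P is empty.
  preimage-*-trivial : preimage P T ≐ ∅ → preimage P (T *) ≐ P
  preimage-*-trivial (enters⊆∅ , _) = (λ (_ , p , path) → start∈P path p) , λ p → _ , p , ε
    where
    start∈P : ∀ {x y} → (T *) x y → P y → P x
    start∈P ε         p = p
    start∈P (t ◅ ts) p = ⊥-elim (enters⊆∅ (_ , start∈P ts p , t))

  image-*-trivial : image T P ≐ ∅ → image (T *) P ≐ P
  image-*-trivial (leaves⊆∅ , _) = (λ (_ , p , path) → end∈P path p) , λ p → _ , p , ε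
    where
    end∈P : ∀ {x y} → (T *) x y → P x → P y
    end∈P ε        p = p
    end∈P (t ◅ _) p = ⊥-elim (leaves⊆∅ (_ , p , t))

idPos : (A : PosObj) → IsPositive A A (idInt (obj A))
idPos A = record
  { cond1  = preimage-IdR
  ; cond2  = image-IdR
  ; cond3a = preimage-EmptyR
  ; cond3b = image-EmptyR
  }

compPos : (A B C : PosObj) (R : IntMor (obj A) (obj B)) (S : IntMor (obj B) (obj C))
  → IsPositive A B R → IsPositive B C S → IsPositive A C (compInt S R)
compPos A B C R S pR pS = record
  { cond1  = cond1
  ; cond2  = cond2
  ; cond3a = cond3a
  ; cond3b = cond3b
  }
  where
  module Rᵖ = IsPositive pR
  module Sᵖ = IsPositive pS

  loop⁺ : Relation (pos (obj B)) (pos (obj B))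
  loop⁺ = r22 R ⊙ r11 S

  loop⁻ : Relation (neg (obj B)) (neg (obj B))
  loop⁻ = r11 S ⊙ r22 R

  loop⁺-fixes-mpPos : preimage (mpPos B) (loop⁺ *) ≐ mpPos B
  loop⁺-fixes-mpPos = preimage-*-trivial (preimage-⊙-≐∅ Rᵖ.cond3a)

  loop⁻-fixes-mpNeg : image (loop⁻ *) (mpNeg B) ≐ mpNeg B
  loop⁻-fixes-mpNeg = image-*-trivial (image-⊙-≐∅ Rᵖ.cond3b)

  mpNeg-via-S : image ((loop⁻ *) ⊙ r21 S) (mpNeg C) ≐ mpNeg B
  mpNeg-via-S = begin
    image ((loop⁻ *) ⊙ r21 S) (mpNeg C)        ≈⟨ image-⊙ ⟩
    image (loop⁻ *) (image (r21 S) (mpNeg C))  ≈⟨ image-cong Sᵖ.cond2 ⟩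
    image (loop⁻ *) (mpNeg B)                  ≈⟨ loop⁻-fixes-mpNeg ⟩
    mpNeg B                                    ∎

  cond1 : preimage (mpPos C) (r12 (compInt S R)) ≐ mpPos A
  cond1 = begin
    preimage (mpPos C) (r12 S ⊙ (loop⁺ *) ⊙ r12 R)            ≈⟨ preimage-⊙ ⟩
    preimage (preimage (mpPos C) (r12 S)) ((loop⁺ *) ⊙ r12 R) ≈⟨ preimage-cong Sᵖ.cond1 ⟩
    preimage (mpPos B) ((loop⁺ *) ⊙ r12 R)                    ≈⟨ preimage-⊙ ⟩
    preimage (preimage (mpPos B) (loop⁺ *)) (r12 R)           ≈⟨ preimage-cong loop⁺-fixes-mpPos ⟩
    preimage (mpPos B) (r12 R)                                ≈⟨ Rᵖ.cond1 ⟩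
    mpPos A                                                   ∎

  cond2 : image (r21 (compInt S R)) (mpNeg C) ≐ mpNeg A
  cond2 = begin
    image (r21 R ⊙ (loop⁻ *) ⊙ r21 S) (mpNeg C)              ≈⟨ image-⊙ ⟩
    image (r21 R) (image ((loop⁻ *) ⊙ r21 S) (mpNeg C))      ≈⟨ image-cong mpNeg-via-S ⟩
    image (r21 R) (mpNeg B)                                  ≈⟨ Rᵖ.cond2 ⟩
    mpNeg A                                                  ∎

  cond3a : preimage (mpPos C) (r22 (compInt S R)) ≐ ∅
  cond3a = ≐-trans preimage-∪ᵣ (∪-≐∅ Sᵖ.cond3a (begin
    preimage (mpPos C) (r12 S ⊙ r22 R ⊙ (loop⁻ *) ⊙ r21 S)            ≈⟨ preimage-⊙ ⟩
    preimage (preimage (mpPos C) (r12 S)) (r22 R ⊙ (loop⁻ *) ⊙ r21 S) ≈⟨ preimage-cong Sᵖ.cond1 ⟩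
    preimage (mpPos B) (r22 R ⊙ (loop⁻ *) ⊙ r21 S)                    ≈⟨ preimage-⊙-≐∅ Rᵖ.cond3a ⟩
    ∅                                                                 ∎))

  cond3b : image (r22 (compInt S R)) (mpNeg C) ≐ ∅
  cond3b = ≐-trans image-∪ᵣ (∪-≐∅ Sᵖ.cond3b (image-⊙-≐∅ (begin
    image (r22 R ⊙ (loop⁻ *) ⊙ r21 S) (mpNeg C)              ≈⟨ image-⊙ ⟩
    image (r22 R) (image ((loop⁻ *) ⊙ r21 S) (mpNeg C))      ≈⟨ image-cong mpNeg-via-S ⟩
    image (r22 R) (mpNeg B)                                  ≈⟨ Rᵖ.cond3b ⟩
    ∅                                                        ∎)))

mainTheorem10 : ((A : PosObj) → IsPositive A A (idInt (obj A)))
    × ((A B C : PosObj) (R : IntMor (obj A) (obj B)) (S : IntMor (obj B) (obj C))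
    → IsPositive A B R → IsPositive B C S → IsPositive A C (compInt S R))
mainTheorem10 = idPos , compPos
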